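{- Let $F\colon\mathbb{B}^{2L}\to\mathbb{B}^{2L}$ be the Boolean Delta-Notch system over a graph $\mathcal{G}$ as in the context. Let $x$ be a fixed point of $F$ and let $x[I]$ be a trap space for $F$ with $I\subseteq\{1,\dots,2L\}$ and $I_D\neq C$. Let $z$ be the state in $x[I]$ with $z_i=1$ for $i\in I$, $i\le L$, and $z_i=0$ for $i\in I$, $i\ge L+1$. Then: (i) there is a path in $AD_F$ from $z$ to $x$; (ii) there is a path in $AD_F$ from every state $y\in x[I]$ with $\kappa(y)=x[I]$ to $z$; (iii) if $S(I)\cap I_D=\emptyset$, then $x[I]$ contains exactly one fixed point of $F$; (iv) if $S(I)\cap I_D\neq\emptyset$, then $x[I]$ contains at least two fixed points of $F$, and $AD_F$ admits a cycle all of whose vertices lie in $x[I]$.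
   Context: Let $L\ge 1$ and let $\mathcal{G}$ be an undirected connected graph without loops on the vertex set $C=\{1,\dots,L\}$. For $i\in C$ let $S(i)$ be the set of neighbours of $i$ in $\mathcal{G}$. $\mathbb{B}=\{0,1\}$. States of $\mathbb{B}^{2L}$ are written $(n,d)=(n_1,\dots,n_L,d_1,\dots,d_L)$. The Boolean Delta-Notch system is $F\colon\mathbb{B}^{2L}\to\mathbb{B}^{2L}$ with $F_i(n,d)=\bigvee_{j\in S(i)}d_j$ (empty disjunction $=0$) and $F_{i+L}(n,d)=1-n_i$. For $I\subseteq\{1,\dots,2L\}$: $I_N=I\cap C$, $I_D=\{i-L: i\in I, i>L\}$, $S(I)=\bigcup_{i\in I_N\cup I_D}S(i)$. $AD_F$ has an edge from $y$ to the state obtained by flipping coordinate $i$ whenever $F_i(y)\neq y_i$. For $y\in\mathbb{B}^{2L}$, the subspace $y[I]$ is $\{w: w_i=y_i\ \forall i\notin I\}$; a trap space is a subspace such that every successor in $AD_F$ of its states lies in it; $\kappa(y)$ is the unique minimal trap space containing $y$. A fixed point is $y$ with $F(y)=y$. -}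

module Defs where

open import Data.Bool using (Bool; true; false; not; _∧_; _∨_; if_then_else_)
open import Data.Nat using (ℕ; _≤_)
open import Data.Fin using (Fin)
open import Data.Sum using (_⊎_; inj₁; inj₂)
open import Data.Product using (Σ; _×_; _,_; ∃; ∃-syntax)
open import Data.Vec using (Vec; lookup; tabulate; updateAt)
open import Data.List using (List; []; _∷_; allFin; _++_; [_])
open import Data.Bool.ListAction using (any)
open import Data.Empty using (⊥)
open import Data.List.Relation.Unary.All using (All)
open import Data.List.Relation.Unary.Linked using (Linked)
open import Data.List.Relation.Unary.Unique.Propositional using (Unique)
open import Relation.Binary.PropositionalEquality using (_≡_; _≢_)
open import Relation.Binary.Construct.Closure.ReflexiveTransitive using (Star)

-- Graph on vertex set C = Fin L (vertex i ↔ paper's i+1), adjacency as Bool matrix.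
record DNGraph : Set where
  field
    L      : ℕ
    L≥1    : 1 ≤ L
    adj    : Fin L → Fin L → Bool
    adj-sym   : ∀ i j → adj i j ≡ adj j i
    adj-irrefl : ∀ i → adj i i ≡ false
    connected : ∀ i j → Star (λ a b → adj a b ≡ true) i j

module DeltaNotch (G : DNGraph) where
  open DNGraph G

  State : Set
  State = Vec Bool L × Vec Bool L

  -- coordinates {1..2L}: inj₁ i is coordinate i (n_i), inj₂ i is coordinate i+L (d_i)
  Coord : Set
  Coord = Fin L ⊎ Fin L

  get : State → Coord → Bool
  get (n , d) (inj₁ i) = lookup n i
  get (n , d) (inj₂ i) = lookup d i

  Fc : State → Coord → Bool
  Fc y (inj₁ i) = any (λ j → adj i j ∧ get y (inj₂ j)) (allFin L)
  Fc y (inj₂ i) = not (get y (inj₁ i))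

  F : State → State
  F y = tabulate (λ i → Fc y (inj₁ i)) , tabulate (λ i → Fc y (inj₂ i))

  flip : State → Coord → State
  flip (n , d) (inj₁ i) = updateAt n i not , d
  flip (n , d) (inj₂ i) = n , updateAt d i not

  Edge : State → State → Set
  Edge y y' = Σ Coord (λ c → Fc y c ≢ get y c × y' ≡ flip y c)

  Path : State → State → Set
  Path = Star Edge

  IndexSet : Set
  IndexSet = Coord → Bool

  InSub : State → IndexSet → State → Set
  InSub x I w = ∀ c → I c ≡ false → get w c ≡ get x c

  IsTrapSpace : State → IndexSet → Set
  IsTrapSpace x I = ∀ w w' → InSub x I w → Edge w w' → InSub x I w'

  KappaIs : State → State → IndexSet → Set
  KappaIs y x I =
    IsTrapSpace x I × InSub x I y ×
    (∀ x' J → IsTrapSpace x' J → InSub x' J y → ∀ w → InSub x I w → InSub x' J w)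

  IsFixed : State → Set
  IsFixed y = F y ≡ y

  zState : State → IndexSet → State
  zState x I = tabulate (λ i → if I (inj₁ i) then true else get x (inj₁ i))
             , tabulate (λ i → if I (inj₂ i) then false else get x (inj₂ i))

  ID≠C : IndexSet → Set
  ID≠C I = ∃[ i ] I (inj₂ i) ≡ false

  SI∩ID-nonempty : IndexSet → Set
  SI∩ID-nonempty I =
    ∃[ j ] ∃[ i ] (I (inj₂ j) ≡ true × (I (inj₁ i) ∨ I (inj₂ i)) ≡ true × adj i j ≡ true)

  IsCycle : List State → Set
  IsCycle [] = ⊥
  IsCycle (v ∷ vs) = Unique (v ∷ vs) × Linked Edge ((v ∷ vs) ++ [ v ])

-- Inside the trap space x[I] around the fixed point x one has I_N ⊆ I_D, and every vertex outside I_N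
-- that is adjacent to I_D lies outside I_D, has d = 0 and is kept at n = 1 by an active neighbour outside
-- I_D. So on x[I] the coordinates of I_N form the Delta-Notch system of the induced graph G[I_N], while
-- n = 0 and d only rises on I_D ∖ I_N.
--   (i)   From z, n falls on I_N wherever x has n = 0, and then d follows n.
--   (iii) Without edges from I_N ∪ I_D into I_D, n on I_N is determined by the fixed coordinates.
--   (iv)  An edge ij inside I_N gives maximal independent sets of G[I_N] through i and through j, hence two
--         fixed points, and an 8-cycle in the coordinates nᵢ, dᵢ, nⱼ, dⱼ of z.
--   (ii)  Raise the vertices of I_N with n = 0 one at a time (possibly borrowing support from a neighbour
--         with n = 1). If no raise is possible, these vertices form a frozen set; traced back to y, it
--         carves out of x[I] a smaller trap space containing y.

module Submission where

open import Defs
open import Data.Bool using (Bool; true; false; not; _∧_; _∨_; if_then_else_)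
import Data.Bool as Bool
open import Data.Bool.Properties
  using (∧-zeroʳ; ∨-zeroʳ; ∨-conicalˡ; ∨-conicalʳ; not-involutive; not-¬; ¬-not)
open import Data.Bool.ListAction using (any)
open import Data.Empty using (⊥-elim)
open import Data.Fin using (Fin; zero; suc)
open import Data.Fin.Properties using (_≟_; any?)
open import Data.Fin.Subset using (∣_∣)
open import Data.Fin.Subset.Properties using (p⊂q⇒∣p∣<∣q∣)
open import Data.List using (List; []; _∷_; allFin; map)
open import Data.List.Membership.Propositional using (_∈_)
open import Data.List.Membership.Propositional.Properties using (∈-allFin)
open import Data.List.Relation.Unary.All using (All; universal)
import Data.List.Relation.Unary.All.Properties as Allₚ
open import Data.List.Relation.Unary.Any using (here; there)
open import Data.List.Relation.Unary.Linked using ([-]; _∷_)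
import Data.List.Relation.Unary.Linked.Properties as Linkedₚ
import Data.List.Relation.Unary.Unique.Propositional.Properties as Uniqueₚ
open import Data.Nat using (ℕ; _<_)
open import Data.Nat.Induction using (<-wellFounded)
open import Data.Product using (Σ; _×_; _,_; ∃; ∃₂; proj₁; proj₂)
import Data.Product.Properties as Productₚ
open import Data.Sum using (_⊎_; inj₁; inj₂)
import Data.Sum.Properties as Sumₚ
open import Data.Vec using (Vec; []; _∷_; lookup; tabulate; updateAt; _[_]≔_; _[_]=_)
open import Data.Vec.Properties
  using ( lookup∘tabulate; tabulate∘lookup; tabulate-cong; lookup⇒[]=; []=⇒lookup
        ; lookup∘updateAt; lookup∘updateAt′; lookup∘update; lookup∘update′
        ; updateAt-commutes; updateAt-updateAt )
open import Induction.WellFounded using (Acc; acc)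
open import Relation.Binary.PropositionalEquality
  using (_≡_; _≢_; refl; sym; trans; cong; cong₂; subst; subst₂; module ≡-Reasoning)
open import Relation.Binary.Definitions using (DecidableEquality)
open import Relation.Binary.Construct.Closure.ReflexiveTransitive using (Star; ε; _◅_; _◅◅_; gmap)
open import Relation.Nullary using (¬_; Dec; yes; no; does)
open import Relation.Nullary.Decidable using (dec-true; from-yes; _×-dec_)

∧-true⁻ : ∀ {a b} → a ∧ b ≡ true → a ≡ true × b ≡ true
∧-true⁻ {true} p = refl , p

∨-true⁻ : ∀ {a b} → a ∨ b ≡ true → a ≡ true ⊎ b ≡ true
∨-true⁻ {true}  _ = inj₁ refl
∨-true⁻ {false} p = inj₂ p

∨-trueʳ : ∀ a {b} → b ≡ true → a ∨ b ≡ true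
∨-trueʳ a p = trans (cong (a ∨_) p) (∨-zeroʳ a)

does-true⁻ : ∀ {p} {P : Set p} (P? : Dec P) → does P? ≡ true → P
does-true⁻ (yes p) _ = p

does-false⁻ : ∀ {p} {P : Set p} (P? : Dec P) → does P? ≡ false → ¬ P
does-false⁻ (no ¬p) _ = ¬p

module _ {a} {A : Set a} (f : A → Bool) where

  any-true⁻ : ∀ xs → any f xs ≡ true → ∃ λ x → f x ≡ true
  any-true⁻ (x ∷ xs) p with ∨-true⁻ p
  ... | inj₁ fx = x , fx
  ... | inj₂ fxs = any-true⁻ xs fxs

  any-true⁺ : ∀ {x} xs → x ∈ xs → f x ≡ true → any f xs ≡ true
  any-true⁺ (y ∷ xs) (here refl) p = cong (_∨ any f xs) p
  any-true⁺ (y ∷ xs) (there x∈xs) p = ∨-trueʳ (f y) (any-true⁺ xs x∈xs p)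

  any-false⁺ : ∀ xs → (∀ x → x ∈ xs → f x ≡ false) → any f xs ≡ false
  any-false⁺ []       _ = refl
  any-false⁺ (x ∷ xs) h = cong₂ _∨_ (h x (here refl)) (any-false⁺ xs (λ y y∈xs → h y (there y∈xs)))

lookup-ext : ∀ {a} {A : Set a} {n} (xs ys : Vec A n) → (∀ i → lookup xs i ≡ lookup ys i) → xs ≡ ys
lookup-ext xs ys h = trans (sym (tabulate∘lookup xs)) (trans (tabulate-cong h) (tabulate∘lookup ys))

-- Recursive in the vector, unlike tabulate, so that patch S f v is neutral and its arguments can be inferred.
patch : ∀ {a} {A : Set a} {n} → (Fin n → Bool) → (Fin n → A) → Vec A n → Vec A n
patch S f []       = []
patch S f (x ∷ xs) = (if S zero then f zero else x) ∷ patch (λ k → S (suc k)) (λ k → f (suc k)) xs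

module _ {a} {A : Set a} where

  lookup-patch : ∀ {n} S f (v : Vec A n) k → lookup (patch S f v) k ≡ (if S k then f k else lookup v k)
  lookup-patch S f (x ∷ xs) zero    = refl
  lookup-patch S f (x ∷ xs) (suc k) = lookup-patch _ _ xs k

  patch-tabulate : ∀ {n} S f (v : Vec A n) → patch S f v ≡ tabulate (λ k → if S k then f k else lookup v k)
  patch-tabulate S f v = lookup-ext _ _ (λ k → trans (lookup-patch S f v k) (sym (lookup∘tabulate _ k)))

  module _ {n} {S : Fin n → Bool} {f : Fin n → A} (v : Vec A n) {k : Fin n} where

    lookup-patch-in : S k ≡ true → lookup (patch S f v) k ≡ f k
    lookup-patch-in e = trans (lookup-patch S f v k) (cong (λ b → if b then f k else lookup v k) e)

    lookup-patch-out : S k ≡ false → lookup (patch S f v) k ≡ lookup v k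
    lookup-patch-out e = trans (lookup-patch S f v k) (cong (λ b → if b then f k else lookup v k) e)

module _ {n : ℕ} where

  private
    tabulate-∈ : ∀ (h : Fin n → Bool) k → h k ≡ true → tabulate h [ k ]= true
    tabulate-∈ h k e = lookup⇒[]= k (tabulate h) (trans (lookup∘tabulate h k) e)

    tabulate-∈⁻ : ∀ (h : Fin n → Bool) k → tabulate h [ k ]= true → h k ≡ true
    tabulate-∈⁻ h k mem = trans (sym (lookup∘tabulate h k)) ([]=⇒lookup mem)

  ∣tabulate∣-< : ∀ {f g : Fin n → Bool} → (∀ k → g k ≡ true → f k ≡ true) →
                 ∀ p → f p ≡ true → g p ≡ false → ∣ tabulate g ∣ < ∣ tabulate f ∣
  ∣tabulate∣-< {f} {g} g⊆f p fp gp =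
    p⊂q⇒∣p∣<∣q∣ ( (λ {k} mem → tabulate-∈ f k (g⊆f k (tabulate-∈⁻ g k mem)))
                , p , tabulate-∈ f p fp , λ mem → not-¬ (tabulate-∈⁻ g p mem) gp)

FlipStep : ∀ {m} → (Fin m → Bool) → Vec Bool m → Vec Bool m → Set
FlipStep g v v′ = ∃ λ i → g i ≢ lookup v i × v′ ≡ updateAt v i not

flipPath : ∀ {m} (g : Fin m → Bool) (v v′ : Vec Bool m) →
           (∀ i → lookup v i ≢ lookup v′ i → g i ≡ lookup v′ i) → Star (FlipStep g) v v′
flipPath g []       []       _ = ε
flipPath g (a ∷ as) (b ∷ bs) h =
  gmap (a ∷_) (λ { (i , g≢ , refl) → suc i , g≢ , refl })
       (flipPath (λ i → g (suc i)) as bs (λ i → h (suc i)))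
    ◅◅ flipHead a b (h zero)
  where
    flipHead : ∀ a b → (a ≢ b → g zero ≡ b) → Star (FlipStep g) (a ∷ bs) (b ∷ bs)
    flipHead false false _      = ε
    flipHead true  true  _      = ε
    flipHead false true  toward = (zero , (λ e → not-¬ (toward (λ ())) e) , refl) ◅ ε
    flipHead true  false toward = (zero , (λ e → not-¬ e (toward (λ ()))) , refl) ◅ ε

module DeltaNotchProperties (G : DNGraph) where
  open DNGraph G
  open DeltaNotch G

  anyNeighbour : (Fin L → Bool) → Fin L → Bool
  anyNeighbour S i = any (λ j → adj i j ∧ S j) (allFin L)

  module _ {S : Fin L → Bool} {i : Fin L} where

    anyNeighbour-true⁻ : anyNeighbour S i ≡ true → ∃ λ j → adj i j ≡ true × S j ≡ true
    anyNeighbour-true⁻ p with any-true⁻ _ (allFin L) p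
    ... | j , q = j , ∧-true⁻ q

    anyNeighbour-true⁺ : ∀ {j} → adj i j ≡ true → S j ≡ true → anyNeighbour S i ≡ true
    anyNeighbour-true⁺ {j} a s = any-true⁺ _ (allFin L) (∈-allFin j) (cong₂ _∧_ a s)

    anyNeighbour-false⁺ : (∀ j → adj i j ≡ true → S j ≡ false) → anyNeighbour S i ≡ false
    anyNeighbour-false⁺ h = any-false⁺ _ (allFin L) (λ j _ → term j)
      where
        term : ∀ j → adj i j ∧ S j ≡ false
        term j with adj i j in e
        ... | false = refl
        ... | true  = h j e

    anyNeighbour-false⁻ : anyNeighbour S i ≡ false → ∀ {j} → adj i j ≡ true → S j ≡ false
    anyNeighbour-false⁻ p a = ¬-not (λ s → not-¬ (anyNeighbour-true⁺ a s) p)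

  anyNeighbour-cong : ∀ {S S′ i} → (∀ j → adj i j ≡ true → S j ≡ S′ j) →
                      anyNeighbour S i ≡ anyNeighbour S′ i
  anyNeighbour-cong {S} {S′} {i} h with anyNeighbour S′ i in e
  ... | true  = let j , a , s = anyNeighbour-true⁻ e in anyNeighbour-true⁺ a (trans (h j a) s)
  ... | false = anyNeighbour-false⁺ (λ j a → trans (h j a) (anyNeighbour-false⁻ e a))

  _≟ᶜ_ : DecidableEquality Coord
  _≟ᶜ_ = Sumₚ.≡-dec _≟_ _≟_

  get-flip : ∀ w c → get (flip w c) c ≡ not (get w c)
  get-flip (n , d) (inj₁ i) = lookup∘updateAt i n
  get-flip (n , d) (inj₂ i) = lookup∘updateAt i d

  get-flip-≢ : ∀ w c c′ → c′ ≢ c → get (flip w c) c′ ≡ get w c′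
  get-flip-≢ (n , d) (inj₁ i) (inj₁ k) ne = lookup∘updateAt′ k i (λ e → ne (cong inj₁ e)) n
  get-flip-≢ (n , d) (inj₁ i) (inj₂ k) ne = refl
  get-flip-≢ (n , d) (inj₂ i) (inj₁ k) ne = refl
  get-flip-≢ (n , d) (inj₂ i) (inj₂ k) ne = lookup∘updateAt′ k i (λ e → ne (cong inj₂ e)) d

  flip-InSub : ∀ {x I w} c → I c ≡ true → InSub x I w → InSub x I (flip w c)
  flip-InSub {w = w} c Ic hw c′ Ic′ with c′ ≟ᶜ c
  ... | yes refl = ⊥-elim (not-¬ Ic Ic′)
  ... | no c′≢c  = trans (get-flip-≢ w c c′ c′≢c) (hw c′ Ic′)

  trap⇒stable : ∀ {x I} → IsTrapSpace x I →
                ∀ {w} → InSub x I w → ∀ c → I c ≡ false → Fc w c ≡ get w c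
  trap⇒stable tr {w} hw c Ic with Fc w c Bool.≟ get w c
  ... | yes e = e
  ... | no ne = ⊥-elim (not-¬ refl
                  (trans (hw c Ic) (trans (sym (tr w (flip w c) hw (c , ne , refl) c Ic)) (get-flip w c))))

  stable⇒trap : ∀ {y J} → (∀ w c → InSub y J w → J c ≡ false → Fc w c ≡ get y c) → IsTrapSpace y J
  stable⇒trap h w .(flip w c) hw (c , ne , refl) c′ Jc′ with c′ ≟ᶜ c
  ... | yes refl = ⊥-elim (ne (trans (h w c hw Jc′) (sym (hw c Jc′))))
  ... | no c′≢c  = trans (get-flip-≢ w c c′ c′≢c) (hw c′ Jc′)

  _∖_ : IndexSet → IndexSet → IndexSet
  (I ∖ K) c = I c ∧ not (K c)

  module _ {I K : IndexSet} {c : Coord} where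

    ∖-fixes : K c ≡ true → (I ∖ K) c ≡ false
    ∖-fixes e = trans (cong (λ b → I c ∧ not b) e) (∧-zeroʳ (I c))

    ∖-fixes-I : I c ≡ false → (I ∖ K) c ≡ false
    ∖-fixes-I e = cong (_∧ not (K c)) e

    ∖-fixed⁻ : (I ∖ K) c ≡ false → I c ≡ false ⊎ K c ≡ true
    ∖-fixed⁻ e with I c | K c
    ... | false | _    = inj₁ refl
    ... | true  | true = inj₂ refl

  restrict-trap : ∀ {x I y} K → IsTrapSpace x I → InSub x I y →
                  (∀ w c → InSub y (I ∖ K) w → K c ≡ true → Fc w c ≡ get y c) → IsTrapSpace y (I ∖ K)
  restrict-trap {x} {I} {y} K tr y∈ h = stable⇒trap stable
    where
      stable : ∀ w c → InSub y (I ∖ K) w → (I ∖ K) c ≡ false → Fc w c ≡ get y c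
      stable w c hw Jc with ∖-fixed⁻ {I} {K} Jc
      ... | inj₂ Kc = h w c hw Kc
      ... | inj₁ Ic = trans (trap⇒stable tr w∈x c Ic) (hw c Jc)
        where
          w∈x : InSub x I w
          w∈x c′ e = trans (hw c′ (∖-fixes-I {I} {K} e)) (y∈ c′ e)

  KappaIs-minimal : ∀ {y x I} K → KappaIs y x I → IsTrapSpace y (I ∖ K) →
                    ∀ c → K c ≡ true → I c ≡ false
  KappaIs-minimal {y} {x} {I} K (_ , y∈ , least) trJ c Kc = ¬-not λ Ic →
    not-¬ refl (sym (trans (sym (get-flip y c))
      (least y (I ∖ K) trJ (λ _ _ → refl) (flip y c) (flip-InSub c Ic y∈) c (∖-fixes {I} {K} Kc))))

  fixed-n : ∀ {n d} → IsFixed (n , d) → ∀ i → lookup n i ≡ anyNeighbour (lookup d) i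
  fixed-n fx i = trans (sym (cong (λ s → lookup (proj₁ s) i) fx)) (lookup∘tabulate _ i)

  fixed-d : ∀ {n d} → IsFixed (n , d) → ∀ i → lookup d i ≡ not (lookup n i)
  fixed-d fx i = trans (sym (cong (λ s → lookup (proj₂ s) i) fx)) (lookup∘tabulate _ i)

  fixed-intro : ∀ {n d} → (∀ i → anyNeighbour (lookup d) i ≡ lookup n i) →
                (∀ i → not (lookup n i) ≡ lookup d i) → IsFixed (n , d)
  fixed-intro hn hd = cong₂ _,_ (lookup-ext _ _ (λ i → trans (lookup∘tabulate _ i) (hn i)))
                                (lookup-ext _ _ (λ i → trans (lookup∘tabulate _ i) (hd i)))

  -- F updates n from d alone and d from n alone, so each half of a state moves coordinatewise.
  n-path : ∀ {n n′ d} → (∀ i → lookup n i ≢ lookup n′ i → anyNeighbour (lookup d) i ≡ lookup n′ i) →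
           Path (n , d) (n′ , d)
  n-path {n} {n′} {d} h =
    gmap (_, d) (λ { (i , ne , refl) → inj₁ i , ne , refl }) (flipPath (anyNeighbour (lookup d)) n n′ h)

  d-path : ∀ {n d d′} → (∀ i → lookup d i ≢ lookup d′ i → not (lookup n i) ≡ lookup d′ i) →
           Path (n , d) (n , d′)
  d-path {n} {d} {d′} h =
    gmap (n ,_) (λ { (i , ne , refl) → inj₂ i , ne , refl }) (flipPath (λ i → not (lookup n i)) d d′ h)

  private
    towards-update : ∀ {v : Vec Bool L} {g : Fin L → Bool} {p b} → g p ≡ b →
                     ∀ i → lookup v i ≢ lookup (v [ p ]≔ b) i → g i ≡ lookup (v [ p ]≔ b) i
    towards-update {v} {g} {p} {b} e i ne with i ≟ p
    ... | yes refl = trans e (sym (lookup∘update p v b))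
    ... | no i≢p   = ⊥-elim (ne (sym (lookup∘update′ i≢p v b)))

  set-n : ∀ {n d p b} → anyNeighbour (lookup d) p ≡ b → Path (n , d) (n [ p ]≔ b , d)
  set-n {n} e = n-path (towards-update {n} e)

  set-d : ∀ {n d p b} → not (lookup n p) ≡ b → Path (n , d) (n , d [ p ]≔ b)
  set-d {n} {d} e = d-path (towards-update {d} e)

  record MaximalIndependentIn (U S : Fin L → Bool) : Set where
    field
      ⊆U          : ∀ a → S a ≡ true → U a ≡ true
      independent : ∀ a b → S a ≡ true → S b ≡ true → adj a b ≡ false
      dominating  : ∀ v → U v ≡ true → S v ≡ true ⊎ anyNeighbour S v ≡ true

  anyNeighbour-maximalIndependent : ∀ {U S} → MaximalIndependentIn U S →
                                    ∀ v → U v ≡ true → anyNeighbour S v ≡ not (S v)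
  anyNeighbour-maximalIndependent {S = S} mis v Uv with S v in Sv
  ... | true  = anyNeighbour-false⁺ λ k a → ¬-not λ Sk →
                  not-¬ a (MaximalIndependentIn.independent mis v k Sv Sk)
  ... | false with MaximalIndependentIn.dominating mis v Uv
  ...   | inj₁ Sv′ = ⊥-elim (not-¬ Sv′ Sv)
  ...   | inj₂ nb  = nb

  module _ (U : Fin L → Bool) where

    private
      Independent : (Fin L → Bool) → Set
      Independent S = (∀ a → S a ≡ true → U a ≡ true)
                    × (∀ a b → S a ≡ true → S b ≡ true → adj a b ≡ false)

      Dominated : (Fin L → Bool) → Fin L → Set
      Dominated S v = S v ≡ true ⊎ anyNeighbour S v ≡ true

      dominated-mono : ∀ {S S′} → (∀ a → S a ≡ true → S′ a ≡ true) →
                       ∀ {v} → Dominated S v → Dominated S′ v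
      dominated-mono S⊆S′ (inj₁ Sv) = inj₁ (S⊆S′ _ Sv)
      dominated-mono S⊆S′ (inj₂ nb) =
        let k , a , Sk = anyNeighbour-true⁻ nb in inj₂ (anyNeighbour-true⁺ a (S⊆S′ k Sk))

      insert-independent : ∀ {S v} → Independent S → U v ≡ true → anyNeighbour S v ≡ false →
                           Independent (λ k → S k ∨ does (k ≟ v))
      insert-independent {S} {v} (⊆U , indep) Uv free = ⊆U′ , indep′
        where
          apart : ∀ b → S b ≡ true → adj v b ≡ false
          apart b Sb = ¬-not λ a → not-¬ (anyNeighbour-true⁺ a Sb) free
          member : ∀ k → S k ∨ does (k ≟ v) ≡ true → S k ≡ true ⊎ k ≡ v
          member k e with ∨-true⁻ e
          ... | inj₁ Sk = inj₁ Sk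
          ... | inj₂ p  = inj₂ (does-true⁻ (k ≟ v) p)
          ⊆U′ : ∀ a → S a ∨ does (a ≟ v) ≡ true → U a ≡ true
          ⊆U′ a e with member a e
          ... | inj₁ Sa   = ⊆U a Sa
          ... | inj₂ refl = Uv
          indep′ : ∀ a b → S a ∨ does (a ≟ v) ≡ true → S b ∨ does (b ≟ v) ≡ true → adj a b ≡ false
          indep′ a b ea eb with member a ea | member b eb
          ... | inj₁ Sa   | inj₁ Sb   = indep a b Sa Sb
          ... | inj₁ Sa   | inj₂ refl = trans (adj-sym a v) (apart a Sa)
          ... | inj₂ refl | inj₁ Sb   = apart b Sb
          ... | inj₂ refl | inj₂ refl = adj-irrefl v

      insert-if-free : ∀ v S → Independent S →
                       ∃ λ S₁ → (∀ a → S a ≡ true → S₁ a ≡ true) × Independent S₁ ×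
                                (U v ≡ true → Dominated S₁ v)
      insert-if-free v S ind with U v in Uv | anyNeighbour S v in nb
      ... | true  | false = (λ k → S k ∨ does (k ≟ v)) , (λ a Sa → cong (_∨ does (a ≟ v)) Sa) ,
                            insert-independent ind Uv nb , λ _ → inj₁ (∨-trueʳ (S v) (dec-true (v ≟ v) refl))
      ... | true  | true  = S , (λ _ Sa → Sa) , ind , λ _ → inj₂ nb
      ... | false | _     = S , (λ _ Sa → Sa) , ind , λ ()

      extend : ∀ vs S → Independent S →
               ∃ λ S′ → (∀ a → S a ≡ true → S′ a ≡ true) × Independent S′ ×
                        (∀ v → v ∈ vs → U v ≡ true → Dominated S′ v)
      extend []       S ind = S , (λ _ Sa → Sa) , ind , λ _ ()
      extend (v ∷ vs) S ind =
        let S₁ , S⊆S₁ , ind₁ , dom-v = insert-if-free v S ind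
            S′ , S₁⊆S′ , ind′ , dom  = extend vs S₁ ind₁
        in S′ , (λ a Sa → S₁⊆S′ a (S⊆S₁ a Sa)) , ind′ ,
           λ { w (here refl) Uw → dominated-mono S₁⊆S′ (dom-v Uw) ; w (there w∈vs) Uw → dom w w∈vs Uw }

    maximalIndependent-∋ : ∀ a → U a ≡ true → ∃ λ S → S a ≡ true × MaximalIndependentIn U S
    maximalIndependent-∋ a Ua =
      let S , a⊆S , (⊆U , indep) , dom = extend (allFin L) (λ k → does (k ≟ a)) singleton-independent
      in S , a⊆S a (dec-true (a ≟ a) refl) ,
         record { ⊆U = ⊆U ; independent = indep ; dominating = λ v → dom v (∈-allFin v) }
      where
        singleton-independent : Independent (λ k → does (k ≟ a))
        singleton-independent =
            (λ k e → subst (λ k → U k ≡ true) (sym (does-true⁻ (k ≟ a) e)) Ua)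
          , λ k l ek el → subst₂ (λ k l → adj k l ≡ false)
                                 (sym (does-true⁻ (k ≟ a) ek)) (sym (does-true⁻ (l ≟ a) el)) (adj-irrefl a)

module FixedPointTrapSpace (G : DNGraph) {nx dx : Vec Bool (DNGraph.L G)} {I : DeltaNotch.IndexSet G}
                           (fx : DeltaNotch.IsFixed G (nx , dx)) (tr : DeltaNotch.IsTrapSpace G (nx , dx) I) where
  open DNGraph G
  open DeltaNotch G
  open DeltaNotchProperties G
  open ≡-Reasoning

  x : State
  x = nx , dx

  stable : ∀ {w} → InSub x I w → ∀ c → I c ≡ false → Fc w c ≡ get w c
  stable = trap⇒stable tr

  I-separates : ∀ {p k} (c : Fin L → Coord) → I (c p) ≡ true → I (c k) ≡ false → k ≢ p
  I-separates c Ip Ik refl = not-¬ Ip Ik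

  N⊆D : ∀ a → I (inj₁ a) ≡ true → I (inj₂ a) ≡ true
  N⊆D a Ia = ¬-not λ Ia′ → not-¬ refl (begin
      lookup nx a                         ≡˘⟨ not-involutive _ ⟩
      not (not (lookup nx a))             ≡˘⟨ cong not (get-flip x (inj₁ a)) ⟩
      not (lookup (updateAt nx a not) a)  ≡⟨ stable (flip-InSub (inj₁ a) Ia (λ _ _ → refl)) (inj₂ a) Ia′ ⟩
      lookup dx a                         ≡⟨ fixed-d fx a ⟩
      not (lookup nx a)                   ∎)

  D-free⇒N-free : ∀ a → I (inj₂ a) ≡ false → I (inj₁ a) ≡ false
  D-free⇒N-free a Ia = ¬-not λ Ia′ → not-¬ (N⊆D a Ia′) Ia

  outer-neighbour-supported : ∀ {k a} → I (inj₁ k) ≡ false → adj k a ≡ true → I (inj₂ a) ≡ true →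
                              lookup nx k ≡ true ×
                              ∃ λ m → adj k m ≡ true × I (inj₂ m) ≡ false × lookup dx m ≡ true
  outer-neighbour-supported {k} {a} Ik ka Ia = nk , support
    where
      fill : Bool → Vec Bool L
      fill b = patch (λ m → I (inj₂ m)) (λ _ → b) dx
      fill-in : ∀ b → InSub x I (nx , fill b)
      fill-in b (inj₁ _) _  = refl
      fill-in b (inj₂ m) Im = lookup-patch-out dx Im
      nk : lookup nx k ≡ true
      nk = trans (sym (stable (fill-in true) (inj₁ k) Ik)) (anyNeighbour-true⁺ ka (lookup-patch-in dx Ia))
      support : ∃ λ m → adj k m ≡ true × I (inj₂ m) ≡ false × lookup dx m ≡ true
      support with anyNeighbour-true⁻ (trans (stable (fill-in false) (inj₁ k) Ik) nk)
      ... | m , km , fm with I (inj₂ m) in Im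
      ...   | true  = ⊥-elim (not-¬ fm (lookup-patch-in dx Im))
      ...   | false = m , km , Im , trans (sym (lookup-patch-out dx Im)) fm

  outer-neighbour-off : ∀ {a k} → I (inj₂ a) ≡ true → adj a k ≡ true → I (inj₁ k) ≡ false →
                        I (inj₂ k) ≡ false × lookup dx k ≡ false
  outer-neighbour-off {a} {k} Ia ak Ik = ¬-not D-bound , trans (fixed-d fx k) (cong not nk)
    where
      ka : adj k a ≡ true
      ka = trans (adj-sym k a) ak
      nk : lookup nx k ≡ true
      nk = proj₁ (outer-neighbour-supported Ik ka Ia)
      D-bound : I (inj₂ k) ≢ true
      D-bound Ik₂ with outer-neighbour-supported Ik ka Ia
      ... | _ , m , km , Im , dm = not-¬ dm (trans (fixed-d fx m) (cong not
              (proj₁ (outer-neighbour-supported (D-free⇒N-free m Im) (trans (adj-sym m k) km) Ik₂))))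

  n-off-on-D∖N : ∀ {t} → I (inj₂ t) ≡ true → I (inj₁ t) ≡ false → lookup nx t ≡ false
  n-off-on-D∖N {t} It It₁ = trans (fixed-n fx t) (anyNeighbour-false⁺ unsupported)
    where
      unsupported : ∀ k → adj t k ≡ true → lookup dx k ≡ false
      unsupported k a with I (inj₁ k) in Ik
      ... | false = proj₂ (outer-neighbour-off It a Ik)
      ... | true  = ⊥-elim (not-¬ It (proj₁ (outer-neighbour-off (N⊆D k Ik) (trans (adj-sym k t) a) It₁)))

  nz dz : Vec Bool L
  nz = patch (λ i → I (inj₁ i)) (λ _ → true) nx
  dz = patch (λ i → I (inj₂ i)) (λ _ → false) dx

  dz-off-near-D : ∀ {p k} → I (inj₂ p) ≡ true → adj p k ≡ true → lookup dz k ≡ false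
  dz-off-near-D {p} {k} Ip a with I (inj₂ k) in Ik
  ... | true  = lookup-patch-in dx Ik
  ... | false = trans (lookup-patch-out dx Ik) (proj₂ (outer-neighbour-off Ip a (D-free⇒N-free k Ik)))

  z⇝x : Path (nz , dz) x
  z⇝x = n-path lower ◅◅ d-path (λ i _ → sym (fixed-d fx i))
    where
      lower : ∀ i → lookup nz i ≢ lookup nx i → anyNeighbour (lookup dz) i ≡ lookup nx i
      lower i ne with I (inj₁ i) in Ii
      ... | false = ⊥-elim (ne (lookup-patch-out nx Ii))
      ... | true  = trans (anyNeighbour-false⁺ (λ k a → dz-off (anyNeighbour-false⁻ unsupported a))) (sym nx-off)
        where
          nx-off : lookup nx i ≡ false
          nx-off = ¬-not (λ e → ne (trans (lookup-patch-in nx Ii) (sym e)))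
          unsupported : anyNeighbour (lookup dx) i ≡ false
          unsupported = trans (sym (fixed-n fx i)) nx-off
          dz-off : ∀ {k} → lookup dx k ≡ false → lookup dz k ≡ false
          dz-off {k} e with I (inj₂ k) in Ik
          ... | true  = lookup-patch-in dx Ik
          ... | false = trans (lookup-patch-out dx Ik) e

  fixed-unique : ¬ SI∩ID-nonempty I → ∀ w → InSub x I w → IsFixed w → w ≡ x
  fixed-unique noEdge (nw , dw) w∈ fw = cong₂ _,_ (lookup-ext _ _ n≡) (lookup-ext _ _ d≡)
    where
      n≡ : ∀ i → lookup nw i ≡ lookup nx i
      n≡ i with I (inj₁ i) in Ii
      ... | false = w∈ (inj₁ i) Ii
      ... | true  = begin
          lookup nw i                 ≡⟨ fixed-n fw i ⟩
          anyNeighbour (lookup dw) i  ≡⟨ anyNeighbour-cong same-d ⟩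
          anyNeighbour (lookup dx) i  ≡˘⟨ fixed-n fx i ⟩
          lookup nx i                 ∎
        where
          same-d : ∀ k → adj i k ≡ true → lookup dw k ≡ lookup dx k
          same-d k a with I (inj₂ k) in Ik
          ... | false = w∈ (inj₂ k) Ik
          ... | true  = ⊥-elim (noEdge (k , i , Ik , cong (_∨ I (inj₂ i)) Ii , a))
      d≡ : ∀ i → lookup dw i ≡ lookup dx i
      d≡ i = trans (fixed-d fw i) (trans (cong not (n≡ i)) (sym (fixed-d fx i)))

  fromIndependent : (Fin L → Bool) → State
  fromIndependent S = patch (λ v → I (inj₁ v)) (λ v → not (S v)) nx , patch (λ v → I (inj₁ v)) S dx

  fromIndependent-InSub : ∀ S → InSub x I (fromIndependent S)
  fromIndependent-InSub S (inj₁ k) Ik = lookup-patch-out nx Ik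
  fromIndependent-InSub S (inj₂ k) Ik = lookup-patch-out dx (D-free⇒N-free k Ik)

  fromIndependent-fixed : ∀ {S} → MaximalIndependentIn (λ v → I (inj₁ v)) S → IsFixed (fromIndependent S)
  fromIndependent-fixed {S} mis = fixed-intro n-stable d-stable
    where
      open MaximalIndependentIn mis using (⊆U)
      nS dS : Vec Bool L
      nS = proj₁ (fromIndependent S)
      dS = proj₂ (fromIndependent S)
      d-stable : ∀ v → not (lookup nS v) ≡ lookup dS v
      d-stable v with I (inj₁ v) in Iv
      ... | true  = trans (cong not (lookup-patch-in nx Iv)) (trans (not-involutive (S v)) (sym (lookup-patch-in dx Iv)))
      ... | false = trans (cong not (lookup-patch-out nx Iv)) (trans (sym (fixed-d fx v)) (sym (lookup-patch-out dx Iv)))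
      n-stable : ∀ v → anyNeighbour (lookup dS) v ≡ lookup nS v
      n-stable v with I (inj₁ v) in Iv
      ... | true = begin
          anyNeighbour (lookup dS) v  ≡⟨ anyNeighbour-cong d-is-S ⟩
          anyNeighbour S v            ≡⟨ anyNeighbour-maximalIndependent mis v Iv ⟩
          not (S v)                   ≡˘⟨ lookup-patch-in nx Iv ⟩
          lookup nS v                 ∎
        where
          d-is-S : ∀ k → adj v k ≡ true → lookup dS k ≡ S k
          d-is-S k a with I (inj₁ k) in Ik
          ... | true  = lookup-patch-in dx Ik
          ... | false = trans (lookup-patch-out dx Ik) (trans (proj₂ (outer-neighbour-off (N⊆D v Iv) a Ik))
                          (sym (¬-not λ Sk → not-¬ (⊆U k Sk) Ik)))
      ... | false with anyNeighbour (λ k → I (inj₁ k)) v in near-N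
      ...   | true = let a , va , Ia = anyNeighbour-true⁻ near-N
                         nv , m , vm , Im , dm = outer-neighbour-supported Iv va (N⊆D a Ia)
                     in trans (anyNeighbour-true⁺ vm (trans (lookup-patch-out dx (D-free⇒N-free m Im)) dm))
                              (sym (trans (lookup-patch-out nx Iv) nv))
      ...   | false = begin
          anyNeighbour (lookup dS) v  ≡⟨ anyNeighbour-cong (λ k a → lookup-patch-out dx
                                                                        (anyNeighbour-false⁻ near-N a)) ⟩
          anyNeighbour (lookup dx) v  ≡˘⟨ fixed-n fx v ⟩
          lookup nx v                 ≡˘⟨ lookup-patch-out nx Iv ⟩
          lookup nS v                 ∎

  TwoFixedPoints : Set
  TwoFixedPoints = Σ State λ w → Σ State λ w′ → w ≢ w′ × InSub x I w × IsFixed w × InSub x I w′ × IsFixed w′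

  two-fixed-points : ∀ {i j} → I (inj₁ i) ≡ true → I (inj₁ j) ≡ true → adj i j ≡ true → TwoFixedPoints
  two-fixed-points {i} {j} Ii Ij ij with maximalIndependent-∋ (λ v → I (inj₁ v)) i Ii
                                       | maximalIndependent-∋ (λ v → I (inj₁ v)) j Ij
  ... | Si , i∈Si , misᵢ | Sj , j∈Sj , misⱼ =
    fromIndependent Si , fromIndependent Sj , differ-at-i ,
    fromIndependent-InSub Si , fromIndependent-fixed misᵢ , fromIndependent-InSub Sj , fromIndependent-fixed misⱼ
    where
      i∉Sj : Sj i ≡ false
      i∉Sj = ¬-not λ i∈Sj → not-¬ ij (MaximalIndependentIn.independent misⱼ i j i∈Sj j∈Sj)
      differ-at-i : fromIndependent Si ≢ fromIndependent Sj
      differ-at-i e =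
        not-¬ (trans (cong (λ w → lookup (proj₁ w) i) e) (trans (lookup-patch-in nx Ii) (cong not i∉Sj)))
              (trans (lookup-patch-in nx Ii) (cong not i∈Si))

  module Oscillation {i j : Fin L} (Ii : I (inj₁ i) ≡ true) (Ij : I (inj₁ j) ≡ true) (ij : adj i j ≡ true) where

    i≢j : i ≢ j
    i≢j refl = not-¬ ij (adj-irrefl i)

    Code : Set
    Code = Bool × Bool × Bool × Bool

    embed : Code → State
    embed (a , b , c , e) = nz [ i ]≔ a [ j ]≔ c , dz [ i ]≔ b [ j ]≔ e

    module _ (v : Vec Bool L) (a c : Bool) where

      at-i : lookup (v [ i ]≔ a [ j ]≔ c) i ≡ a
      at-i = trans (lookup∘update′ i≢j (v [ i ]≔ a) c) (lookup∘update i v a)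

      at-j : lookup (v [ i ]≔ a [ j ]≔ c) j ≡ c
      at-j = lookup∘update j (v [ i ]≔ a) c

      elsewhere : ∀ k → k ≢ i → k ≢ j → lookup (v [ i ]≔ a [ j ]≔ c) k ≡ lookup v k
      elsewhere k k≢i k≢j = trans (lookup∘update′ k≢j (v [ i ]≔ a) c) (lookup∘update′ k≢i v a)

      flip-i : updateAt (v [ i ]≔ a [ j ]≔ c) i not ≡ v [ i ]≔ not a [ j ]≔ c
      flip-i = trans (updateAt-commutes i j i≢j (v [ i ]≔ a)) (cong (_[ j ]≔ c) (updateAt-updateAt i v))

      flip-j : updateAt (v [ i ]≔ a [ j ]≔ c) j not ≡ v [ i ]≔ a [ j ]≔ not c
      flip-j = updateAt-updateAt j (v [ i ]≔ a)

    embed-InSub : ∀ s → InSub x I (embed s)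
    embed-InSub (a , b , c , e) (inj₁ k) Ik =
      trans (elsewhere nz a c k (I-separates inj₁ Ii Ik) (I-separates inj₁ Ij Ik)) (lookup-patch-out nx Ik)
    embed-InSub (a , b , c , e) (inj₂ k) Ik =
      trans (elsewhere dz b e k (I-separates inj₂ (N⊆D i Ii) Ik) (I-separates inj₂ (N⊆D j Ij) Ik))
            (lookup-patch-out dx Ik)

    embed-injective : ∀ {s s′} → embed s ≡ embed s′ → s ≡ s′
    embed-injective {s} {s′} e = trans (sym (read-embed s)) (trans (cong read e) (read-embed s′))
      where
        read : State → Code
        read (n , d) = lookup n i , lookup d i , lookup n j , lookup d j
        read-embed : ∀ s → read (embed s) ≡ s
        read-embed (a , b , c , e) rewrite at-i nz a c | at-i dz b e | at-j nz a c | at-j dz b e = refl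

    private
      only-partner : ∀ {p q} → p ≢ q → I (inj₂ p) ≡ true → adj p q ≡ true → ∀ (u : Vec Bool L) →
                     (∀ k → k ≢ p → k ≢ q → lookup u k ≡ lookup dz k) →
                     anyNeighbour (lookup u) p ≡ lookup u q
      only-partner {p} {q} p≢q Ip pq u u≈dz with lookup u q in uq
      ... | true  = anyNeighbour-true⁺ pq uq
      ... | false = anyNeighbour-false⁺ off
        where
          off : ∀ k → adj p k ≡ true → lookup u k ≡ false
          off k pk with k ≟ q | k ≟ p
          ... | yes refl | _        = uq
          ... | no _     | yes refl = ⊥-elim (not-¬ pk (adj-irrefl k))
          ... | no k≢q   | no k≢p   = trans (u≈dz k k≢p k≢q) (dz-off-near-D Ip pk)

    support-i : ∀ b e → anyNeighbour (lookup (dz [ i ]≔ b [ j ]≔ e)) i ≡ e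
    support-i b e = trans (only-partner i≢j (N⊆D i Ii) ij (dz [ i ]≔ b [ j ]≔ e) (elsewhere dz b e)) (at-j dz b e)

    support-j : ∀ b e → anyNeighbour (lookup (dz [ i ]≔ b [ j ]≔ e)) j ≡ b
    support-j b e =
      trans (only-partner (λ j≡i → i≢j (sym j≡i)) (N⊆D j Ij) (trans (adj-sym j i) ij) (dz [ i ]≔ b [ j ]≔ e)
                          (λ k k≢j k≢i → elsewhere dz b e k k≢i k≢j))
            (at-i dz b e)

    edge-nᵢ : ∀ {a b c e} → e ≢ a → Edge (embed (a , b , c , e)) (embed (not a , b , c , e))
    edge-nᵢ {a} {b} {c} {e} e≢a =
      inj₁ i , (λ p → e≢a (trans (sym (support-i b e)) (trans p (at-i nz a c))))
             , sym (cong (_, _) (flip-i nz a c))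

    edge-nⱼ : ∀ {a b c e} → b ≢ c → Edge (embed (a , b , c , e)) (embed (a , b , not c , e))
    edge-nⱼ {a} {b} {c} {e} b≢c =
      inj₁ j , (λ p → b≢c (trans (sym (support-j b e)) (trans p (at-j nz a c))))
             , sym (cong (_, _) (flip-j nz a c))

    edge-dᵢ : ∀ {a b c e} → not a ≢ b → Edge (embed (a , b , c , e)) (embed (a , not b , c , e))
    edge-dᵢ {a} {b} {c} {e} ¬a≢b =
      inj₂ i , (λ p → ¬a≢b (trans (cong not (sym (at-i nz a c))) (trans p (at-i dz b e))))
             , sym (cong (_ ,_) (flip-i dz b e))

    edge-dⱼ : ∀ {a b c e} → not c ≢ e → Edge (embed (a , b , c , e)) (embed (a , b , c , not e))
    edge-dⱼ {a} {b} {c} {e} ¬c≢e =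
      inj₂ j , (λ p → ¬c≢e (trans (cong not (sym (at-j nz a c))) (trans p (at-j dz b e))))
             , sym (cong (_ ,_) (flip-j dz b e))

    _≟-code_ : DecidableEquality Code
    _≟-code_ = Productₚ.≡-dec Bool._≟_ (Productₚ.≡-dec Bool._≟_ (Productₚ.≡-dec Bool._≟_ Bool._≟_))

    open import Data.List.Relation.Unary.Unique.DecPropositional _≟-code_ using (unique?)

    cycleCodes : List Code
    cycleCodes = (true  , false , true  , false)
               ∷ (false , false , true  , false)
               ∷ (false , false , false , false)
               ∷ (false , true  , false , false)
               ∷ (false , true  , false , true)
               ∷ (true  , true  , false , true)
               ∷ (true  , true  , true  , true)
               ∷ (true  , false , true  , true)
               ∷ []

    cycle : IsCycle (map embed cycleCodes)
    cycle = Uniqueₚ.map⁺ embed-injective (from-yes (unique? cycleCodes))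
          , Linkedₚ.map⁺ {R = Edge} {f = embed}
              ( edge-nᵢ (λ ()) ∷ edge-nⱼ (λ ()) ∷ edge-dᵢ (λ ()) ∷ edge-dⱼ (λ ())
              ∷ edge-nᵢ (λ ()) ∷ edge-nⱼ (λ ()) ∷ edge-dᵢ (λ ()) ∷ edge-dⱼ (λ ()) ∷ [-])

    cycle-InSub : All (InSub x I) (map embed cycleCodes)
    cycle-InSub = Allₚ.map⁺ (universal embed-InSub cycleCodes)

  record Stuck (n d : Vec Bool L) (a : Fin L) : Set where
    constructor stuck-at
    field
      ∈N          : I (inj₁ a) ≡ true
      inactive    : lookup n a ≡ false
      unsupported : ∀ k → adj a k ≡ true → lookup d k ≡ false

  Propped : Vec Bool L → Vec Bool L → (Fin L → Bool) → Fin L → Set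
  Propped n d A k = lookup n k ≡ true ×
                    ∃ λ m → adj k m ≡ true × lookup d m ≡ true × (I (inj₂ m) ≡ false ⊎ A m ≡ true)

  record Frozen (n d : Vec Bool L) (A : Fin L → Bool) : Set where
    field
      inhabited : ∃ λ a → A a ≡ true
      stuck     : ∀ a → A a ≡ true → Stuck n d a
      propped   : ∀ k → anyNeighbour A k ≡ true → Propped n d A k

  frozenCoords : Vec Bool L → (Fin L → Bool) → IndexSet
  frozenCoords d A (inj₁ v) = A v ∨ anyNeighbour A v
  frozenCoords d A (inj₂ v) = (A v ∧ lookup d v) ∨ anyNeighbour A v

  frozen-trap : ∀ {ny dy A} → InSub x I (ny , dy) → Frozen ny dy A →
                IsTrapSpace (ny , dy) (I ∖ frozenCoords dy A)
  frozen-trap {ny} {dy} {A} y∈ fr = restrict-trap (frozenCoords dy A) tr y∈ stable-frozen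
    where
      open Frozen fr
      K : IndexSet
      K = frozenCoords dy A
      near-A : ∀ {a k} → A a ≡ true → adj a k ≡ true → anyNeighbour A k ≡ true
      near-A {a} {k} Aa ak = anyNeighbour-true⁺ (trans (adj-sym k a) ak) Aa
      stable-frozen : ∀ w c → InSub (ny , dy) (I ∖ K) w → K c ≡ true → Fc w c ≡ get (ny , dy) c
      stable-frozen (nw , dw) (inj₁ v) w∈ Kc with ∨-true⁻ Kc
      ... | inj₁ Av =
        trans (anyNeighbour-false⁺ λ k vk →
                 trans (w∈ (inj₂ k) (∖-fixes {I} {K} (∨-trueʳ _ (near-A Av vk))))
                       (Stuck.unsupported (stuck v Av) k vk))
              (sym (Stuck.inactive (stuck v Av)))
      ... | inj₂ nb with propped v nb
      ...   | nv , m , vm , dm , m-held =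
        trans (anyNeighbour-true⁺ vm (trans (w∈ (inj₂ m) (held m-held)) dm)) (sym nv)
        where
          held : I (inj₂ m) ≡ false ⊎ A m ≡ true → (I ∖ K) (inj₂ m) ≡ false
          held (inj₁ Im) = ∖-fixes-I {I} {K} Im
          held (inj₂ Am) = ∖-fixes {I} {K} (cong (_∨ anyNeighbour A m) (cong₂ _∧_ Am dm))
      stable-frozen (nw , dw) (inj₂ v) w∈ Kc with ∨-true⁻ Kc
      ... | inj₁ Avd = let Av , dv = ∧-true⁻ Avd in
        trans (cong not (trans (w∈ (inj₁ v) (∖-fixes {I} {K} (cong (_∨ anyNeighbour A v) Av)))
                               (Stuck.inactive (stuck v Av))))
              (sym dv)
      ... | inj₂ nb with anyNeighbour-true⁻ nb
      ...   | a , va , Aa =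
        trans (cong not (trans (w∈ (inj₁ v) (∖-fixes {I} {K} (∨-trueʳ (A v) nb))) (proj₁ (propped v nb))))
              (sym (Stuck.unsupported (stuck a Aa) v (trans (adj-sym a v) va)))

  kappa-unfrozen : ∀ {ny dy} → KappaIs (ny , dy) x I → ∀ A → ¬ Frozen ny dy A
  kappa-unfrozen {ny} {dy} κ@(_ , y∈ , _) A fr =
    not-¬ (Stuck.∈N (stuck a Aa))
          (KappaIs-minimal (frozenCoords dy A) κ (frozen-trap y∈ fr) (inj₁ a) (cong (_∨ anyNeighbour A a) Aa))
    where
      open Frozen fr
      a : Fin L
      a = proj₁ inhabited
      Aa : A a ≡ true
      Aa = proj₂ inhabited

  kappa-D∖N-off : ∀ {ny dy t} → KappaIs (ny , dy) x I →
                  I (inj₂ t) ≡ true → I (inj₁ t) ≡ false → lookup dy t ≡ false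
  kappa-D∖N-off {ny} {dy} {t} κ@(_ , y∈ , _) It It₁ = ¬-not λ dt →
    not-¬ It (KappaIs-minimal K κ (restrict-trap K tr y∈ (stable-at-t dt)) (inj₂ t) (dec-true (t ≟ t) refl))
    where
      K : IndexSet
      K (inj₁ _) = false
      K (inj₂ k) = does (k ≟ t)
      stable-at-t : lookup dy t ≡ true →
                    ∀ w c → InSub (ny , dy) (I ∖ K) w → K c ≡ true → Fc w c ≡ get (ny , dy) c
      stable-at-t dt (nw , dw) (inj₂ k) w∈ Kc with does-true⁻ (k ≟ t) Kc
      ... | refl = trans (cong not (trans (w∈ (inj₁ t) (∖-fixes-I {I} {K} It₁))
                                          (trans (y∈ (inj₁ t) It₁) (n-off-on-D∖N It It₁))))
                         (sym dt)

  -- Invariant of the descent to z. A frozen set after a step yields one before it, and d cannot fall on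
  -- I_D ∖ I_N, so both must be absent already at y.
  record Admissible (n d : Vec Bool L) : Set where
    field
      inSub    : InSub x I (n , d)
      unfrozen : ∀ A → ¬ Frozen n d A
      D∖N-off  : ∀ {t} → I (inj₂ t) ≡ true → I (inj₁ t) ≡ false → lookup d t ≡ false

  kappa-admissible : ∀ {ny dy} → KappaIs (ny , dy) x I → Admissible ny dy
  kappa-admissible κ@(_ , y∈ , _) =
    record { inSub = y∈ ; unfrozen = kappa-unfrozen κ ; D∖N-off = kappa-D∖N-off κ }

  StuckTraceable : (n d n′ d′ : Vec Bool L) → Set
  StuckTraceable n d n′ d′ = ∀ a → Stuck n′ d′ a →
    Stuck n d a × lookup d a ≡ lookup d′ a × (∀ k → adj a k ≡ true → lookup n′ k ≡ true → lookup n k ≡ true)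

  frozen-traceback : ∀ {n d n′ d′ A} → InSub x I (n , d) → InSub x I (n′ , d′) → StuckTraceable n d n′ d′ →
                     Frozen n′ d′ A → Frozen n d A
  frozen-traceback {n} {d} {n′} {d′} {A} w∈ w′∈ trace fr = record
    { inhabited = inhabited
    ; stuck     = λ a Aa → proj₁ (trace a (stuck a Aa))
    ; propped   = propped′
    }
    where
      open Frozen fr
      propped′ : ∀ k → anyNeighbour A k ≡ true → Propped n d A k
      propped′ k nb with anyNeighbour-true⁻ nb | propped k nb
      ... | a , ka , Aa | nk , m , km , dm , m-held =
        proj₂ (proj₂ (trace a (stuck a Aa))) k (trans (adj-sym a k) ka) nk , m , km , d-held m-held , m-held
        where
          d-held : I (inj₂ m) ≡ false ⊎ A m ≡ true → lookup d m ≡ true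
          d-held (inj₁ Im) = trans (w∈ (inj₂ m) Im) (trans (sym (w′∈ (inj₂ m) Im)) dm)
          d-held (inj₂ Am) = trans (proj₁ (proj₂ (trace m (stuck m Am)))) dm

  admissible-changing : ∀ {n d n′ d′} (C : Fin L → Bool) → Admissible n d →
    (∀ k → C k ≡ true → I (inj₁ k) ≡ true) →
    (∀ k → C k ≡ false → lookup n′ k ≡ lookup n k × lookup d′ k ≡ lookup d k) →
    (∀ k → C k ≡ true → lookup d′ k ≡ true) →
    (∀ k → C k ≡ true → lookup n′ k ≡ false → ∃ λ k′ → adj k k′ ≡ true × C k′ ≡ true) →
    Admissible n′ d′
  admissible-changing {n} {d} {n′} {d′} C adm C⊆N same d′-on n′-off⇒near = record
    { inSub    = w′∈
    ; unfrozen = λ A fr → unfrozen A (frozen-traceback inSub w′∈ trace fr)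
    ; D∖N-off  = λ It It₁ → trans (proj₂ (same _ (outside It₁))) (D∖N-off It It₁)
    }
    where
      open Admissible adm
      outside : ∀ {k} → I (inj₁ k) ≡ false → C k ≡ false
      outside {k} Ik = ¬-not λ Ck → not-¬ (C⊆N k Ck) Ik
      w′∈ : InSub x I (n′ , d′)
      w′∈ (inj₁ k) Ik = trans (proj₁ (same k (outside Ik))) (inSub (inj₁ k) Ik)
      w′∈ (inj₂ k) Ik = trans (proj₂ (same k (outside (D-free⇒N-free k Ik)))) (inSub (inj₂ k) Ik)
      unchanged : ∀ {a} → Stuck n′ d′ a → ∀ {k} → adj a k ≡ true → C k ≡ false
      unchanged st ak = ¬-not λ Ck → not-¬ (d′-on _ Ck) (Stuck.unsupported st _ ak)
      trace : StuckTraceable n d n′ d′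
      trace a st@(stuck-at Ia na off) =
        stuck-at Ia (trans (sym (proj₁ (same a Ca))) na) off-before , sym (proj₂ (same a Ca)) , n-before
        where
          Ca : C a ≡ false
          Ca = ¬-not λ Ca′ → let k , ak , Ck = n′-off⇒near a Ca′ na in not-¬ Ck (unchanged st ak)
          off-before : ∀ k → adj a k ≡ true → lookup d k ≡ false
          off-before k ak = trans (sym (proj₂ (same k (unchanged st ak)))) (off k ak)
          n-before : ∀ k → adj a k ≡ true → lookup n′ k ≡ true → lookup n k ≡ true
          n-before k ak nk = trans (sym (proj₁ (same k (unchanged st ak)))) nk

  unsettled : Vec Bool L → Fin L → Bool
  unsettled n v = I (inj₁ v) ∧ not (lookup n v)

  unsettled⇒N : ∀ n {v} → unsettled n v ≡ true → I (inj₁ v) ≡ true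
  unsettled⇒N n e = proj₁ (∧-true⁻ e)

  unsettled⇒off : ∀ n {v} → unsettled n v ≡ true → lookup n v ≡ false
  unsettled⇒off n e = trans (sym (not-involutive _)) (cong not (proj₂ (∧-true⁻ e)))

  unsettled⁺ : ∀ n {v} → I (inj₁ v) ≡ true → lookup n v ≡ false → unsettled n v ≡ true
  unsettled⁺ n Iv nv = cong₂ _∧_ Iv (cong not nv)

  pending : Vec Bool L → ℕ
  pending n = ∣ tabulate (unsettled n) ∣

  pending-drop : ∀ {n n′ p} → (∀ k → k ≢ p → lookup n′ k ≡ lookup n k) → lookup n′ p ≡ true →
                 unsettled n p ≡ true → pending n′ < pending n
  pending-drop {n} {n′} {p} same np up =
    ∣tabulate∣-< shrinks p up (trans (cong (λ b → I (inj₁ p) ∧ not b) np) (∧-zeroʳ _))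
    where
      shrinks : ∀ k → unsettled n′ k ≡ true → unsettled n k ≡ true
      shrinks k u with k ≟ p
      ... | yes refl = ⊥-elim (not-¬ np (unsettled⇒off n′ u))
      ... | no k≢p   = trans (cong (λ b → I (inj₁ k) ∧ not b) (sym (same k k≢p))) u

  raise : ∀ {n d p} → lookup n p ≡ false → anyNeighbour (lookup d) p ≡ true →
          Path (n , d) (n [ p ]≔ true , d [ p ]≔ true)
  raise {n} {d} {p} np sp = set-d (cong not np) ◅◅ set-n (trans (anyNeighbour-cong not-self) sp)
    where
      not-self : ∀ k → adj p k ≡ true → lookup (d [ p ]≔ true) k ≡ lookup d k
      not-self k pk = lookup∘update′ (λ { refl → not-¬ pk (adj-irrefl p) }) d true

  Progress : Vec Bool L → Vec Bool L → Set
  Progress n d = ∃₂ λ n′ d′ → Path (n , d) (n′ , d′) × Admissible n′ d′ × pending n′ < pending n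

  raise-supported : ∀ {n d p} → Admissible n d → unsettled n p ≡ true → anyNeighbour (lookup d) p ≡ true →
                    Progress n d
  raise-supported {n} {d} {p} adm up sp =
    n [ p ]≔ true , d [ p ]≔ true , raise np sp ,
    admissible-changing (λ k → does (k ≟ p)) adm C⊆N same raised near ,
    pending-drop {n} {n [ p ]≔ true} (λ k k≢p → lookup∘update′ k≢p n true) (lookup∘update p n true) up
    where
      Ip : I (inj₁ p) ≡ true
      Ip = unsettled⇒N n up
      np : lookup n p ≡ false
      np = unsettled⇒off n up
      C⊆N : ∀ k → does (k ≟ p) ≡ true → I (inj₁ k) ≡ true
      C⊆N k e with does-true⁻ (k ≟ p) e
      ... | refl = Ip
      same : ∀ k → does (k ≟ p) ≡ false →
             lookup (n [ p ]≔ true) k ≡ lookup n k × lookup (d [ p ]≔ true) k ≡ lookup d k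
      same k e = lookup∘update′ k≢p n true , lookup∘update′ k≢p d true
        where
          k≢p : k ≢ p
          k≢p = does-false⁻ (k ≟ p) e
      raised : ∀ k → does (k ≟ p) ≡ true → lookup (d [ p ]≔ true) k ≡ true
      raised k e with does-true⁻ (k ≟ p) e
      ... | refl = lookup∘update p d true
      near : ∀ k → does (k ≟ p) ≡ true → lookup (n [ p ]≔ true) k ≡ false →
             ∃ λ k′ → adj k k′ ≡ true × does (k′ ≟ p) ≡ true
      near k e nk with does-true⁻ (k ≟ p) e
      ... | refl = ⊥-elim (not-¬ (lookup∘update p n true) nk)

  raise-pair : ∀ {n d v k₀} → Admissible n d → unsettled n v ≡ true → adj v k₀ ≡ true → unsettled n k₀ ≡ true →
               Progress n d
  raise-pair {n} {d} {v} {k₀} adm uv vk uk =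
    n′ , d′ , set-d (cong not nk) ◅◅ raise nv (anyNeighbour-true⁺ vk (lookup∘update k₀ d true)) ,
    admissible-changing C adm C⊆N same raised near ,
    pending-drop {n} {n′} (λ k k≢v → lookup∘update′ k≢v n true) (lookup∘update v n true) uv
    where
      Iv : I (inj₁ v) ≡ true
      Iv = unsettled⇒N n uv
      nv : lookup n v ≡ false
      nv = unsettled⇒off n uv
      Ik : I (inj₁ k₀) ≡ true
      Ik = unsettled⇒N n uk
      nk : lookup n k₀ ≡ false
      nk = unsettled⇒off n uk
      k₀≢v : k₀ ≢ v
      k₀≢v refl = not-¬ vk (adj-irrefl v)
      n′ d′ : Vec Bool L
      n′ = n [ v ]≔ true
      d′ = d [ k₀ ]≔ true [ v ]≔ true
      C : Fin L → Bool
      C k = does (k ≟ v) ∨ does (k ≟ k₀)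
      C-cases : ∀ {k} → C k ≡ true → k ≡ v ⊎ k ≡ k₀
      C-cases {k} e with ∨-true⁻ e
      ... | inj₁ p = inj₁ (does-true⁻ (k ≟ v) p)
      ... | inj₂ p = inj₂ (does-true⁻ (k ≟ k₀) p)
      C⊆N : ∀ k → C k ≡ true → I (inj₁ k) ≡ true
      C⊆N k e with C-cases {k} e
      ... | inj₁ refl = Iv
      ... | inj₂ refl = Ik
      same : ∀ k → C k ≡ false → lookup n′ k ≡ lookup n k × lookup d′ k ≡ lookup d k
      same k e = lookup∘update′ k≢v n true
               , trans (lookup∘update′ k≢v (d [ k₀ ]≔ true) true) (lookup∘update′ k≢k₀ d true)
        where
          k≢v = does-false⁻ (k ≟ v) (∨-conicalˡ _ _ e)
          k≢k₀ = does-false⁻ (k ≟ k₀) (∨-conicalʳ _ _ e)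
      raised : ∀ k → C k ≡ true → lookup d′ k ≡ true
      raised k e with C-cases {k} e
      ... | inj₁ refl = lookup∘update v (d [ k₀ ]≔ true) true
      ... | inj₂ refl = trans (lookup∘update′ k₀≢v (d [ k₀ ]≔ true) true) (lookup∘update k₀ d true)
      near : ∀ k → C k ≡ true → lookup n′ k ≡ false → ∃ λ k′ → adj k k′ ≡ true × C k′ ≡ true
      near k e nk′ with C-cases {k} e
      ... | inj₁ refl = ⊥-elim (not-¬ (lookup∘update v n true) nk′)
      ... | inj₂ refl = v , trans (adj-sym k₀ v) vk , cong (_∨ does (v ≟ k₀)) (dec-true (v ≟ v) refl)

  module Borrowing {n d : Vec Bool L} {j a : Fin L} (adm : Admissible n d)
    (unsupported : ∀ v → unsettled n v ≡ true → anyNeighbour (lookup d) v ≡ false)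
    (isolated : ∀ v → unsettled n v ≡ true → anyNeighbour (unsettled n) v ≡ false)
    (Ij : I (inj₁ j) ≡ true) (nj : lookup n j ≡ true) (ja : adj j a ≡ true) (ua : unsettled n a ≡ true)
    (quiet : ∀ m → adj j m ≡ true → unsettled n m ≡ true → lookup d m ≡ false) where

    open Admissible adm

    Ia : I (inj₁ a) ≡ true
    Ia = unsettled⇒N n ua
    na : lookup n a ≡ false
    na = unsettled⇒off n ua

    a≢j : a ≢ j
    a≢j refl = not-¬ nj na

    -- j drops n and raises d to support a, and is then raised again with a's support
    d₁ n₂ d₂ n₃ d₃ n₄ d₄ : Vec Bool L
    d₁ = patch (adj j) (λ _ → false) d
    n₂ = n [ j ]≔ false
    d₂ = d₁ [ j ]≔ true
    n₃ = n₂ [ a ]≔ true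
    d₃ = d₂ [ a ]≔ true
    n₄ = n₃ [ j ]≔ true
    d₄ = d₃ [ j ]≔ true

    neighbour-active : ∀ k → adj j k ≡ true → lookup d k ≡ true → lookup n k ≡ true
    neighbour-active k jk dk with I (inj₁ k) in Ik
    ... | true  = ¬-not λ nk → not-¬ dk (quiet k jk (unsettled⁺ n Ik nk))
    ... | false = trans (inSub (inj₁ k) Ik)
                        (proj₁ (outer-neighbour-supported Ik (trans (adj-sym k j) jk) (N⊆D j Ij)))

    silence : Path (n , d) (n , d₁)
    silence = d-path off
      where
        off : ∀ k → lookup d k ≢ lookup d₁ k → not (lookup n k) ≡ lookup d₁ k
        off k ne with adj j k in jk
        ... | false = ⊥-elim (ne (sym (lookup-patch-out d jk)))
        ... | true  = trans (cong not (neighbour-active k jk dk)) (sym (lookup-patch-in d jk))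
          where
            dk : lookup d k ≡ true
            dk = ¬-not λ dk-off → ne (trans dk-off (sym (lookup-patch-in d jk)))

    path : Path (n , d) (n₄ , d₄)
    path = silence
       ◅◅ set-n (anyNeighbour-false⁺ λ k jk → lookup-patch-in d jk)
       ◅◅ set-d (cong not (lookup∘update j n false))
       ◅◅ raise (trans (lookup∘update′ a≢j n false) na)
                (anyNeighbour-true⁺ (trans (adj-sym a j) ja) (lookup∘update j d₁ true))
       ◅◅ raise (trans (lookup∘update′ (λ e → a≢j (sym e)) n₂ true) (lookup∘update j n false))
                (anyNeighbour-true⁺ ja (lookup∘update a d₂ true))

    n₄-a : lookup n₄ a ≡ true
    n₄-a = trans (lookup∘update′ a≢j n₃ true) (lookup∘update a n₂ true)

    n₄-elsewhere : ∀ k → k ≢ a → lookup n₄ k ≡ lookup n k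
    n₄-elsewhere k k≢a with k ≟ j
    ... | yes refl = trans (lookup∘update j n₃ true) (sym nj)
    ... | no k≢j   = trans (lookup∘update′ k≢j n₃ true)
                           (trans (lookup∘update′ k≢a n₂ true) (lookup∘update′ k≢j n false))

    d₄-j : lookup d₄ j ≡ true
    d₄-j = lookup∘update j d₃ true

    d₄-elsewhere : ∀ k → k ≢ j → k ≢ a → lookup d₄ k ≡ lookup d₁ k
    d₄-elsewhere k k≢j k≢a = trans (lookup∘update′ k≢j d₃ true)
                                   (trans (lookup∘update′ k≢a d₂ true) (lookup∘update′ k≢j d₁ true))

    d₄-outside-N : ∀ {k} → I (inj₁ k) ≡ false → lookup d₄ k ≡ lookup d k
    d₄-outside-N {k} Ik = trans (d₄-elsewhere k (I-separates inj₁ Ij Ik) (I-separates inj₁ Ia Ik)) d₁-k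
      where
        d₁-k : lookup d₁ k ≡ lookup d k
        d₁-k with adj j k in jk
        ... | false = lookup-patch-out d jk
        ... | true  = let Ik₂ , dxk = outer-neighbour-off (N⊆D j Ij) jk Ik in
                      trans (lookup-patch-in d jk) (sym (trans (inSub (inj₂ k) Ik₂) dxk))

    trace : StuckTraceable n d n₄ d₄
    trace b (stuck-at Ib n₄b off₄) =
      stuck-at Ib nb (λ k bk → anyNeighbour-false⁻ (unsupported b ub) bk) , d-same , n-before
      where
        b≢a : b ≢ a
        b≢a refl = not-¬ n₄-a n₄b
        nb : lookup n b ≡ false
        nb = trans (sym (n₄-elsewhere b b≢a)) n₄b
        ub : unsettled n b ≡ true
        ub = unsettled⁺ n Ib nb
        d-same : lookup d b ≡ lookup d₄ b
        d-same = sym (trans (d₄-elsewhere b (λ { refl → not-¬ nj nb }) b≢a)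
                            (lookup-patch-out d (¬-not λ jb → not-¬ d₄-j (off₄ j (trans (adj-sym b j) jb)))))
        n-before : ∀ k → adj b k ≡ true → lookup n₄ k ≡ true → lookup n k ≡ true
        n-before k bk nk with k ≟ a
        ... | yes refl = ⊥-elim (not-¬ (anyNeighbour-true⁺ bk ua) (isolated b ub))
        ... | no k≢a   = trans (sym (n₄-elsewhere k k≢a)) nk

    admissible : Admissible n₄ d₄
    admissible = record
      { inSub    = n₄d₄∈
      ; unfrozen = λ A fr → unfrozen A (frozen-traceback inSub n₄d₄∈ trace fr)
      ; D∖N-off  = λ It It₁ → trans (d₄-outside-N It₁) (D∖N-off It It₁)
      }
      where
        n₄d₄∈ : InSub x I (n₄ , d₄)
        n₄d₄∈ (inj₁ k) Ik = trans (n₄-elsewhere k (I-separates inj₁ Ia Ik)) (inSub (inj₁ k) Ik)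
        n₄d₄∈ (inj₂ k) Ik = trans (d₄-outside-N (D-free⇒N-free k Ik)) (inSub (inj₂ k) Ik)

    progress : Progress n d
    progress = n₄ , d₄ , path , admissible , pending-drop {n} {n₄} n₄-elsewhere n₄-a ua

  stranded-frozen : ∀ {n d} → InSub x I (n , d) → ∀ {v₀} → unsettled n v₀ ≡ true →
    (∀ v → unsettled n v ≡ true → anyNeighbour (lookup d) v ≡ false) →
    (∀ v → unsettled n v ≡ true → anyNeighbour (unsettled n) v ≡ false) →
    (∀ j → I (inj₁ j) ≡ true → lookup n j ≡ true → anyNeighbour (unsettled n) j ≡ true →
       anyNeighbour (λ m → unsettled n m ∧ lookup d m) j ≡ true) →
    Frozen n d (unsettled n)
  stranded-frozen {n} {d} nd∈ {v₀} u₀ unsupported isolated lends = record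
    { inhabited = v₀ , u₀
    ; stuck     = λ a ua → stuck-at (unsettled⇒N n ua) (unsettled⇒off n ua)
                                    (λ k ak → anyNeighbour-false⁻ (unsupported a ua) ak)
    ; propped   = propped
    }
    where
      propped : ∀ k → anyNeighbour (unsettled n) k ≡ true → Propped n d (unsettled n) k
      propped k nb with I (inj₁ k) in Ik
      ... | false = let a , ka , ua = anyNeighbour-true⁻ nb
                        nk , m , km , Im , dm = outer-neighbour-supported Ik ka (N⊆D a (unsettled⇒N n ua))
                    in trans (nd∈ (inj₁ k) Ik) nk , m , km , trans (nd∈ (inj₂ m) Im) dm , inj₁ Im
      ... | true  = let nk = ¬-not λ nk → not-¬ nb (isolated k (unsettled⁺ n Ik nk))
                        m , km , umd = anyNeighbour-true⁻ (lends k Ik nk nb)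
                        um , dm = ∧-true⁻ umd
                    in nk , m , km , dm , inj₂ um

  settled⇝z : ∀ {n d} → Admissible n d → (∀ v → unsettled n v ≡ false) → Path (n , d) (nz , dz)
  settled⇝z {n} {d} adm none = subst (λ n′ → Path (n , d) (n′ , dz)) n≡nz (d-path toward-dz)
    where
      open Admissible adm
      N-on : ∀ {k} → I (inj₁ k) ≡ true → lookup n k ≡ true
      N-on {k} Ik = ¬-not λ nk → not-¬ (unsettled⁺ n Ik nk) (none k)
      n≡nz : n ≡ nz
      n≡nz = lookup-ext n nz n≈nz
        where
          n≈nz : ∀ k → lookup n k ≡ lookup nz k
          n≈nz k with I (inj₁ k) in Ik
          ... | true  = trans (N-on Ik) (sym (lookup-patch-in nx Ik))
          ... | false = trans (inSub (inj₁ k) Ik) (sym (lookup-patch-out nx Ik))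
      toward-dz : ∀ k → lookup d k ≢ lookup dz k → not (lookup n k) ≡ lookup dz k
      toward-dz k ne with I (inj₂ k) in Ik₂
      ... | false = ⊥-elim (ne (trans (inSub (inj₂ k) Ik₂) (sym (lookup-patch-out dx Ik₂))))
      ... | true with I (inj₁ k) in Ik₁
      ...   | true  = trans (cong not (N-on Ik₁)) (sym (lookup-patch-in dx Ik₂))
      ...   | false = ⊥-elim (ne (trans (D∖N-off Ik₂ Ik₁) (sym (lookup-patch-in dx Ik₂))))

  lend-or-freeze : ∀ {n d} → Admissible n d → ∀ {v₀} → unsettled n v₀ ≡ true →
    (∀ v → unsettled n v ≡ true → anyNeighbour (lookup d) v ≡ false) →
    (∀ v → unsettled n v ≡ true → anyNeighbour (unsettled n) v ≡ false) →
    Progress n d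
  lend-or-freeze {n} {d} adm u₀ unsupported isolated
    with any? (λ j → I (inj₁ j) Bool.≟ true ×-dec lookup n j Bool.≟ true ×-dec
                     anyNeighbour (unsettled n) j Bool.≟ true ×-dec
                     anyNeighbour (λ m → unsettled n m ∧ lookup d m) j Bool.≟ false)
  ... | yes (j , Ij , nj , nb , quiet) =
    let a , ja , ua = anyNeighbour-true⁻ nb in
    Borrowing.progress adm unsupported isolated Ij nj ja ua
      (λ m jm um → trans (cong (_∧ lookup d m) (sym um)) (anyNeighbour-false⁻ quiet jm))
  ... | no ∄lender =
    ⊥-elim (Admissible.unfrozen adm (unsettled n)
      (stranded-frozen (Admissible.inSub adm) u₀ unsupported isolated
         (λ j Ij nj nb → ¬-not λ quiet → ∄lender (j , Ij , nj , nb , quiet))))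

  progress : ∀ {n d} → Admissible n d → ∀ {v₀} → unsettled n v₀ ≡ true → Progress n d
  progress {n} {d} adm u₀
    with any? (λ p → unsettled n p Bool.≟ true ×-dec anyNeighbour (lookup d) p Bool.≟ true)
  ... | yes (p , up , sp) = raise-supported adm up sp
  ... | no ∄supported
    with any? (λ v → unsettled n v Bool.≟ true ×-dec anyNeighbour (unsettled n) v Bool.≟ true)
  ...   | yes (v , uv , nb) = let k , vk , uk = anyNeighbour-true⁻ nb in raise-pair adm uv vk uk
  ...   | no ∄pair =
    lend-or-freeze adm u₀ (λ v uv → ¬-not λ sv → ∄supported (v , uv , sv))
                          (λ v uv → ¬-not λ nb → ∄pair (v , uv , nb))

  reach-z : ∀ {n d} → Acc _<_ (pending n) → Admissible n d → Path (n , d) (nz , dz)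
  reach-z {n} (acc rec) adm with any? (λ v → unsettled n v Bool.≟ true)
  ... | no ∄unsettled = settled⇝z adm (λ v → ¬-not λ uv → ∄unsettled (v , uv))
  ... | yes (v , uv) with progress adm uv
  ...   | n′ , d′ , path , adm′ , lt = path ◅◅ reach-z (rec lt) adm′

  kappa⇝z : ∀ y → KappaIs y x I → Path y (nz , dz)
  kappa⇝z (ny , dy) κ = reach-z (<-wellFounded (pending ny)) (kappa-admissible κ)

  D-edge-consequences : ∀ {i j} → I (inj₂ j) ≡ true → (I (inj₁ i) ∨ I (inj₂ i)) ≡ true → adj i j ≡ true →
    TwoFixedPoints × Σ (List State) (λ vs → IsCycle vs × All (InSub x I) vs)
  D-edge-consequences {i} {j} Ij Ii ij = two-fixed-points iN jN ij , map embed cycleCodes , cycle , cycle-InSub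
    where
      iD : I (inj₂ i) ≡ true
      iD with ∨-true⁻ Ii
      ... | inj₁ Ii₁ = N⊆D i Ii₁
      ... | inj₂ Ii₂ = Ii₂
      iN : I (inj₁ i) ≡ true
      iN = ¬-not λ Ii₁ → not-¬ iD (proj₁ (outer-neighbour-off Ij (trans (adj-sym j i) ij) Ii₁))
      jN : I (inj₁ j) ≡ true
      jN = ¬-not λ Ij₁ → not-¬ Ij (proj₁ (outer-neighbour-off iD ij Ij₁))
      open Oscillation iN jN ij

proposition7 : (G : DNGraph) → let open DeltaNotch G in
    (x : State) (I : IndexSet) →
    IsFixed x → IsTrapSpace x I → ID≠C I →
    (Path (zState x I) x)
    × (∀ y → InSub x I y → KappaIs y x I → Path y (zState x I))
    × (¬ SI∩ID-nonempty I →
        Σ State (λ w → (InSub x I w × IsFixed w)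
          × (∀ w' → InSub x I w' → IsFixed w' → w' ≡ w)))
    × (SI∩ID-nonempty I →
        (Σ State (λ w → Σ State (λ w' → w ≢ w'
          × InSub x I w × IsFixed w × InSub x I w' × IsFixed w')))
        × Σ (List State) (λ vs → IsCycle vs × All (InSub x I) vs))
proposition7 G (nx , dx) I fx tr _ =
    subst (λ z → Path z x) z≡ z⇝x
  , (λ y _ κ → subst (Path y) z≡ (kappa⇝z y κ))
  , (λ noEdge → x , ((λ _ _ → refl) , fx) , fixed-unique noEdge)
  , λ { (j , i , Ij , Ii , ij) → D-edge-consequences Ij Ii ij }
  where
    open DeltaNotch G
    open FixedPointTrapSpace G fx tr
    z≡ : (nz , dz) ≡ zState x I
    z≡ = cong₂ _,_ (patch-tabulate _ _ nx) (patch-tabulate _ _ dx)
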